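{- Let $G$ be a finite simple graph (undirected, no loops, no multiple edges) with $E$ edges, and let $k\geq 3$ be an integer. Then the number $C_k(G)$ of cycles of length $k$ in $G$ satisfies $C_k(G) \leq 2^{k/2-1} E^{k/2}$.
   Context: A cycle of length $k$ in $G$ is a subgraph of $G$ isomorphic to the cycle graph on $k$ vertices. -}

module Defs where

open import Data.Nat using (ℕ; zero; suc; _+_; _<ᵇ_)
open import Data.Bool using (Bool; true; false; if_then_else_; _∧_)
open import Data.Fin using (Fin; toℕ)
import Data.Fin as F
open import Data.Product using (Σ; ∃; _×_)
open import Data.Sum using (_⊎_)
open import Function.Definitions using (Injective)
open import Relation.Binary.PropositionalEquality using (_≡_)

-- Finite simple graph on vertex set Fin n: Bool-valued adjacency,
-- symmetric (undirected) and irreflexive (no loops); a relation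
-- automatically excludes multiple edges.
record SimpleGraph (n : ℕ) : Set where
  field
    adj    : Fin n → Fin n → Bool
    sym    : ∀ x y → adj x y ≡ adj y x
    irrefl : ∀ x → adj x x ≡ false
open SimpleGraph public

sumFin : (n : ℕ) → (Fin n → ℕ) → ℕ
sumFin zero    f = 0
sumFin (suc n) f = f F.zero + sumFin n (λ i → f (F.suc i))

edgeCount : ∀ {n} → SimpleGraph n → ℕ
edgeCount {n} G =
  sumFin n (λ x → sumFin n (λ y →
    if (toℕ x <ᵇ toℕ y) ∧ adj G x y then 1 else 0))

record Subgraph {n : ℕ} (G : SimpleGraph n) : Set where
  field
    vert     : Fin n → Bool
    edge     : Fin n → Fin n → Bool
    edge-sym : ∀ x y → edge x y ≡ edge y x
    edge-adj : ∀ x y → edge x y ≡ true → adj G x y ≡ true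
    edge-end : ∀ x y → edge x y ≡ true → vert x ≡ true × vert y ≡ true
open Subgraph public

SameSubgraph : ∀ {n} {G : SimpleGraph n} → Subgraph G → Subgraph G → Set
SameSubgraph H H' =
  (∀ x → vert H x ≡ vert H' x) × (∀ x y → edge H x y ≡ edge H' x y)

CycSucc : (k : ℕ) → Fin k → Fin k → Set
CycSucc k i j = (suc (toℕ i) ≡ toℕ j) ⊎ (suc (toℕ i) ≡ k × toℕ j ≡ 0)

CycAdj : (k : ℕ) → Fin k → Fin k → Set
CycAdj k i j = CycSucc k i j ⊎ CycSucc k j i

IsCycleOfLength : ∀ {n} {G : SimpleGraph n} → (k : ℕ) → Subgraph G → Set
IsCycleOfLength {n} k H =
  Σ (Fin k → Fin n) λ φ →
    Injective _≡_ _≡_ φ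
    × (∀ i → vert H (φ i) ≡ true)
    × (∀ x → vert H x ≡ true → ∃ λ i → φ i ≡ x)
    × (∀ i j → edge H (φ i) (φ j) ≡ true → CycAdj k i j)
    × (∀ i j → CycAdj k i j → edge H (φ i) (φ j) ≡ true)

module Submission where

-- Let W l = Σᵤ (Aˡ)ᵤᵤ count the closed walks of length l, A being the adjacency matrix.
-- Running through a k-cycle in either direction from a fixed vertex gives two closed walks of
-- length k; a walk determines the cycle it runs through, and for k ≥ 3 the two directions
-- differ, so 2 C_k ≤ W k. Cauchy–Schwarz on W (1 + (k-1)) = Σᵤ Σ_w Aᵤ_w (Aᵏ⁻¹)_wᵤ gives
-- W k ² ≤ W 2 · W (2(k-1)). Finally W (2p) ≤ (2E)ᵖ: a closed walk of length 2p is determined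
-- by its first 2p-1 steps, there are 2E walks of length 1, and putting two steps in front of
-- a walk multiplies the count by at most 2E, the first being one of 2E arcs and the second
-- ending where the walk starts. Hence 4 C_k² ≤ (2E)ᵏ.

open import Data.Bool using (Bool; true; false; if_then_else_; _∧_)
open import Data.Bool.Properties using (⇔→≡)
open import Data.Fin using (Fin; zero; suc; toℕ; splitAt; join)
open import Data.Fin.Properties
  using (_≟_; 0≢1+n; suc-injective; toℕ-injective; toℕ<n; toℕ-fromℕ<; join-splitAt)
open import Data.List using (_∷_; [])
open import Data.Nat
  using (ℕ; zero; suc; _+_; _*_; _^_; _∸_; _≤_; _<_; z≤n; s≤s; z<s; _<ᵇ_; NonZero; >-nonZero⁻¹)
open import Data.Nat.DivMod using (_mod_; m<n⇒m%n≡m; n%n≡0)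
open import Data.Nat.Properties hiding (_≟_; suc-injective; 0≢1+n)
open import Data.Nat.Tactic.RingSolver using (solve; solve-∀)
open import Data.Product using (_×_; _,_; ∃-syntax; swap)
open import Data.Sum using (_⊎_; inj₁; inj₂; [_,_]′; reduce)
import Data.Sum as Sum
open import Data.Unit using (⊤)
open import Defs hiding (sym)
open import Function using (_∘_)
open import Function.Bundles using (mk⇔)
open import Level using (0ℓ)
open import Relation.Binary.Definitions using (tri<; tri≈; tri>)
open import Relation.Binary.PropositionalEquality
open import Relation.Nullary using (¬_; does; yes; no; contradiction)
open import Relation.Nullary.Decidable using (dec-true; dec-false; does-⇔)
open import Relation.Nullary.Decidable.Core using (T?)
open import Relation.Unary using (Pred; Decidable)
open import Relation.Unary.Properties using (U?; _∩?_)

open import Algebra.Properties.Semiring.Sum +-*-semiring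
  using (sum; sum-syntax; sum-cong-≗; sum-replicate-zero; ∑-comm; ∑-distrib-+; *-distribˡ-sum; *-distribʳ-sum)

4*[m*n]≤[m+n]*[m+n] : ∀ m n → 4 * (m * n) ≤ (m + n) * (m + n)
4*[m*n]≤[m+n]*[m+n] m n = [ ordered , flipped ]′ (≤-total m n)
  where
  open ≤-Reasoning
  ordered : ∀ {m n} → m ≤ n → 4 * (m * n) ≤ (m + n) * (m + n)
  ordered {m} m≤n with e , refl ← m≤n⇒∃[o]m+o≡n m≤n = begin
    4 * (m * (m + e))               ≤⟨ m≤m+n _ (e * e) ⟩
    4 * (m * (m + e)) + e * e       ≡⟨ solve (m ∷ e ∷ []) ⟩
    (m + (m + e)) * (m + (m + e))   ∎
  flipped : n ≤ m → 4 * (m * n) ≤ (m + n) * (m + n)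
  flipped n≤m = subst₂ _≤_ (cong (4 *_) (*-comm n m)) (cong (λ s → s * s) (+-comm n m)) (ordered n≤m)

m*m≤n*n⇒m≤n : ∀ {m n} → m * m ≤ n * n → m ≤ n
m*m≤n*n⇒m≤n mm≤nn = ≮⇒≥ (λ n<m → <⇒≱ (*-mono-< n<m n<m) mm≤nn)

o*o≤m*n⇒2*o≤m+n : ∀ o m n → o * o ≤ m * n → 2 * o ≤ m + n
o*o≤m*n⇒2*o≤m+n o m n oo≤mn = m*m≤n*n⇒m≤n (begin
  2 * o * (2 * o)     ≡⟨ solve (o ∷ []) ⟩
  4 * (o * o)         ≤⟨ *-monoʳ-≤ 4 oo≤mn ⟩
  4 * (m * n)         ≤⟨ 4*[m*n]≤[m+n]*[m+n] m n ⟩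
  (m + n) * (m + n)   ∎)
  where open ≤-Reasoning

cauchy-schwarz-+ : ∀ x y a b c d → x * x ≤ a * b → y * y ≤ c * d →
                   (x + y) * (x + y) ≤ (a + c) * (b + d)
cauchy-schwarz-+ x y a b c d xx≤ab yy≤cd = begin
  (x + y) * (x + y)                ≡⟨ solve (x ∷ y ∷ []) ⟩
  x * x + y * y + 2 * (x * y)      ≤⟨ +-mono-≤ (+-mono-≤ xx≤ab yy≤cd) 2xy≤ad+cb ⟩
  a * b + c * d + (a * d + c * b)  ≡⟨ solve (a ∷ b ∷ c ∷ d ∷ []) ⟩
  (a + c) * (b + d)                ∎
  where
  open ≤-Reasoning
  2xy≤ad+cb : 2 * (x * y) ≤ a * d + c * b
  2xy≤ad+cb = o*o≤m*n⇒2*o≤m+n (x * y) (a * d) (c * b) (begin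
    x * y * (x * y)  ≡⟨ [m*n]*[o*p]≡[m*o]*[n*p] x y x y ⟩
    x * x * (y * y)  ≤⟨ *-mono-≤ xx≤ab yy≤cd ⟩
    a * b * (c * d)  ≡⟨ solve (a ∷ b ∷ c ∷ d ∷ []) ⟩
    a * d * (c * b)  ∎)

[m+m]^n≡2^n*m^n : ∀ m n → (m + m) ^ n ≡ 2 ^ n * m ^ n
[m+m]^n≡2^n*m^n m zero    = refl
[m+m]^n≡2^n*m^n m (suc n) = trans (cong ((m + m) *_) ([m+m]^n≡2^n*m^n m n)) (regroup m (2 ^ n) (m ^ n))
  where
  regroup : ∀ m a b → (m + m) * (a * b) ≡ 2 * a * (m * b)
  regroup = solve-∀

halve-square-bound : ∀ m e j → (m + m) * (m + m) ≤ (e + e) ^ (2 + j) → m * m ≤ 2 ^ j * e ^ (2 + j)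
halve-square-bound m e j bound = *-cancelˡ-≤ 4 (begin
  4 * (m * m)                ≡⟨ solve (m ∷ []) ⟩
  (m + m) * (m + m)          ≤⟨ bound ⟩
  (e + e) ^ (2 + j)          ≡⟨ [m+m]^n≡2^n*m^n e (2 + j) ⟩
  2 ^ (2 + j) * e ^ (2 + j)  ≡⟨ cong (_* e ^ (2 + j)) (^-distribˡ-+-* 2 2 j) ⟩
  4 * 2 ^ j * e ^ (2 + j)    ≡⟨ *-assoc 4 (2 ^ j) (e ^ (2 + j)) ⟩
  4 * (2 ^ j * e ^ (2 + j))  ∎)
  where open ≤-Reasoning

<ᵇ-true : ∀ {m n} → m < n → (m <ᵇ n) ≡ true
<ᵇ-true m<n = dec-true (T? _) (<⇒<ᵇ m<n)

<ᵇ-false : ∀ {m n} → n ≤ m → (m <ᵇ n) ≡ false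
<ᵇ-false n≤m = dec-false (T? _) (≤⇒≯ n≤m ∘ <ᵇ⇒< _ _)

sumFin≡sum : ∀ n (f : Fin n → ℕ) → sumFin n f ≡ sum f
sumFin≡sum zero    f = refl
sumFin≡sum (suc n) f = cong (f zero +_) (sumFin≡sum n (f ∘ suc))

sum-mono-≤ : ∀ {N} {f g : Fin N → ℕ} → (∀ i → f i ≤ g i) → sum f ≤ sum g
sum-mono-≤ {zero}  f≤g = z≤n
sum-mono-≤ {suc N} f≤g = +-mono-≤ (f≤g zero) (sum-mono-≤ (f≤g ∘ suc))

cauchy-schwarz : ∀ {N} (x p q : Fin N → ℕ) → (∀ i → x i * x i ≤ p i * q i) →
                 sum x * sum x ≤ sum p * sum q
cauchy-schwarz {zero}  x p q xx≤pq = z≤n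
cauchy-schwarz {suc N} x p q xx≤pq =
  cauchy-schwarz-+ (x zero) (sum (x ∘ suc)) (p zero) (q zero) (sum (p ∘ suc)) (sum (q ∘ suc))
    (xx≤pq zero) (cauchy-schwarz (x ∘ suc) (p ∘ suc) (q ∘ suc) (xx≤pq ∘ suc))

-- Written with if_then_else_ so that edgeCount is literally a double sum of indicators.
𝟙 : Bool → ℕ
𝟙 b = if b then 1 else 0

𝟙-∧ : ∀ a b → 𝟙 (a ∧ b) ≡ 𝟙 a * 𝟙 b
𝟙-∧ false b = refl
𝟙-∧ true  b = sym (*-identityˡ (𝟙 b))

δ : ∀ {n} → Fin n → Fin n → ℕ
δ u v = 𝟙 (does (u ≟ v))

δ-sym : ∀ {n} (u v : Fin n) → δ u v ≡ δ v u
δ-sym u v = cong 𝟙 (does-⇔ (mk⇔ sym sym) (u ≟ v) (v ≟ u))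

sum-δˡ : ∀ {n} (u : Fin n) (g : Fin n → ℕ) → ∑[ w < n ] (δ u w * g w) ≡ g u
sum-δˡ {suc n} zero    g = trans (cong₂ _+_ (*-identityˡ (g zero)) (sum-replicate-zero n)) (+-identityʳ (g zero))
sum-δˡ {suc n} (suc u) g = sum-δˡ u (g ∘ suc)

sum-δʳ : ∀ {n} (v : Fin n) (g : Fin n → ℕ) → ∑[ w < n ] (g w * δ w v) ≡ g v
sum-δʳ v g = trans (sum-cong-≗ (λ w → trans (*-comm (g w) _) (cong (_* g w) (δ-sym w v)))) (sum-δˡ v g)

count : ∀ {N} {P : Pred (Fin N) 0ℓ} → Decidable P → ℕ
count {N} P? = ∑[ i < N ] 𝟙 (does (P? i))

count-U : ∀ N → count {N} U? ≡ N
count-U zero    = refl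
count-U (suc N) = cong suc (count-U N)

count-∅ : ∀ {N} {P : Pred (Fin N) 0ℓ} (P? : Decidable P) → (∀ i → ¬ P i) → count P? ≡ 0
count-∅ {N} P? ∉P = trans (sum-cong-≗ (λ i → cong 𝟙 (dec-false (P? i) (∉P i)))) (sum-replicate-zero N)

count≤1 : ∀ {N} {P : Pred (Fin N) 0ℓ} (P? : Decidable P) →
          (∀ {i j} → P i → P j → i ≡ j) → count P? ≤ 1
count≤1 {zero}  P? unique = z≤n
count≤1 {suc N} P? unique with P? zero
... | yes p₀ = ≤-reflexive (cong suc (count-∅ (P? ∘ suc) (λ i pᵢ → 0≢1+n (unique p₀ pᵢ))))
... | no ¬p₀ = count≤1 (P? ∘ suc) (λ pᵢ pⱼ → suc-injective (unique pᵢ pⱼ))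

count-partition : ∀ {N n} {P : Pred (Fin N) 0ℓ} (P? : Decidable P) (g : Fin N → Fin n) →
                  count P? ≡ ∑[ w < n ] count ((λ i → g i ≟ w) ∩? P?)
count-partition {N} {n} P? g = begin
  ∑[ i < N ] 𝟙 (does (P? i))
    ≡⟨ sum-cong-≗ (λ i → sum-δˡ (g i) (λ _ → 𝟙 (does (P? i)))) ⟨
  ∑[ i < N ] ∑[ w < n ] (δ (g i) w * 𝟙 (does (P? i)))
    ≡⟨ sum-cong-≗ (λ i → sum-cong-≗ (λ w → 𝟙-∧ (does (g i ≟ w)) (does (P? i)))) ⟨
  ∑[ i < N ] ∑[ w < n ] 𝟙 (does (g i ≟ w) ∧ does (P? i))
    ≡⟨ ∑-comm (λ i w → 𝟙 (does (g i ≟ w) ∧ does (P? i))) ⟩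
  ∑[ w < n ] count ((λ i → g i ≟ w) ∩? P?) ∎
  where open ≡-Reasoning

-- Walks

-- A walk of length l is a function ℕ → Fin n of which only the values at 0, …, l matter.
_≈[_]_ : {A : Set} → (ℕ → A) → ℕ → (ℕ → A) → Set
w ≈[ l ] w′ = ∀ t → t ≤ l → w t ≡ w′ t

≈-sym : {A : Set} {w w′ : ℕ → A} {l : ℕ} → w ≈[ l ] w′ → w′ ≈[ l ] w
≈-sym w≈w′ t t≤l = sym (w≈w′ t t≤l)

≈-zero : {A : Set} {w w′ : ℕ → A} → w 0 ≡ w′ 0 → w ≈[ 0 ] w′
≈-zero w₀≡w′₀ .0 z≤n = w₀≡w′₀

≈-suc : {A : Set} {w w′ : ℕ → A} {l : ℕ} →
        w 0 ≡ w′ 0 → (w ∘ suc) ≈[ l ] (w′ ∘ suc) → w ≈[ suc l ] w′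
≈-suc w₀≡w′₀ tail≈ zero    _         = w₀≡w′₀
≈-suc w₀≡w′₀ tail≈ (suc t) (s≤s t≤l) = tail≈ t t≤l

record IsWalk {n} (G : SimpleGraph n) (l : ℕ) (u v : Fin n) (w : ℕ → Fin n) : Set where
  field
    starts : w 0 ≡ u
    ends   : w l ≡ v
    steps  : ∀ {t} → t < l → adj G (w t) (w (suc t)) ≡ true
open IsWalk

module _ {n} {G : SimpleGraph n} {l : ℕ} {u v : Fin n} {w : ℕ → Fin n} where

  isWalk-head : IsWalk G (suc l) u v w → adj G u (w 1) ≡ true
  isWalk-head walk = subst (λ x → adj G x (w 1) ≡ true) (starts walk) (steps walk z<s)

  isWalk-tail : IsWalk G (suc l) u v w → IsWalk G l (w 1) v (w ∘ suc)
  isWalk-tail walk = record { starts = refl ; ends = ends walk ; steps = λ t<l → steps walk (s≤s t<l) }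

module WalkCount {n} (G : SimpleGraph n) where

  A : Fin n → Fin n → ℕ
  A u v = 𝟙 (adj G u v)

  walks : ℕ → Fin n → Fin n → ℕ
  walks zero    u v = δ u v
  walks (suc l) u v = ∑[ w < n ] (A u w * walks l w v)

  closedWalks : ℕ → ℕ
  closedWalks l = ∑[ u < n ] walks l u u

  walksFrom : ℕ → Fin n → ℕ
  walksFrom l u = ∑[ v < n ] walks l u v

  allWalks : ℕ → ℕ
  allWalks l = ∑[ u < n ] walksFrom l u

  arcCount : ℕ
  arcCount = ∑[ u < n ] ∑[ v < n ] A u v

  count≤walks : ∀ {N} l {u v} {P : Pred (Fin N) 0ℓ} (P? : Decidable P) (f : Fin N → ℕ → Fin n) →
                (∀ {i} → P i → IsWalk G l u v (f i)) →
                (∀ {i j} → P i → P j → f i ≈[ l ] f j → i ≡ j) →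
                count P? ≤ walks l u v
  count≤walks zero {u} {v} P? f walk injective with u ≟ v
  ... | yes refl = count≤1 P? λ pᵢ pⱼ →
    injective pᵢ pⱼ (≈-zero (trans (starts (walk pᵢ)) (sym (starts (walk pⱼ)))))
  ... | no  u≢v  = ≤-reflexive (count-∅ P? λ i pᵢ →
    u≢v (trans (sym (starts (walk pᵢ))) (ends (walk pᵢ))))
  count≤walks (suc l) {u} {v} P? f walk injective = begin
    count P?                                     ≡⟨ count-partition P? (λ i → f i 1) ⟩
    ∑[ w < n ] count ((λ i → f i 1 ≟ w) ∩? P?)   ≤⟨ sum-mono-≤ bySecondVertex ⟩
    walks (suc l) u v                            ∎
    where
    open ≤-Reasoning
    bySecondVertex : ∀ w → count ((λ i → f i 1 ≟ w) ∩? P?) ≤ A u w * walks l w v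
    bySecondVertex w with adj G u w in uw
    ... | true  = ≤-trans
      (count≤walks l ((λ i → f i 1 ≟ w) ∩? P?) (λ i → f i ∘ suc)
        (λ { (refl , pᵢ) → isWalk-tail (walk pᵢ) })
        (λ (_ , pᵢ) (_ , pⱼ) tail≈ →
          injective pᵢ pⱼ (≈-suc (trans (starts (walk pᵢ)) (sym (starts (walk pⱼ)))) tail≈)))
      (≤-reflexive (sym (*-identityˡ _)))
    ... | false = ≤-reflexive (count-∅ ((λ i → f i 1 ≟ w) ∩? P?)
      λ { i (refl , pᵢ) → contradiction (trans (sym uw) (isWalk-head (walk pᵢ))) λ () })

  closedWalkFamily≤closedWalks : ∀ {N} l (f : Fin N → ℕ → Fin n) →
    (∀ i → IsWalk G l (f i 0) (f i 0) (f i)) →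
    (∀ {i j} → f i ≈[ l ] f j → i ≡ j) →
    N ≤ closedWalks l
  closedWalkFamily≤closedWalks {N} l f closed injective = begin
    N
      ≡⟨ count-U N ⟨
    count {N} U?
      ≡⟨ count-partition U? (λ i → f i 0) ⟩
    ∑[ u < n ] count ((λ i → f i 0 ≟ u) ∩? U?)
      ≤⟨ sum-mono-≤ (λ u →
           count≤walks l ((λ i → f i 0 ≟ u) ∩? U?) f (startingAt u) (λ _ _ → injective)) ⟩
    closedWalks l ∎
    where
    open ≤-Reasoning
    startingAt : ∀ u {i} → f i 0 ≡ u × ⊤ → IsWalk G l u u (f i)
    startingAt u {i} (fᵢ₀≡u , _) = subst (λ x → IsWalk G l x x (f i)) fᵢ₀≡u (closed i)

  walks-+ : ∀ p q u v → walks (p + q) u v ≡ ∑[ w < n ] (walks p u w * walks q w v)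
  walks-+ zero    q u v = sym (sum-δˡ u (λ w → walks q w v))
  walks-+ (suc p) q u v = begin
    ∑[ w < n ] (A u w * walks (p + q) w v)
      ≡⟨ sum-cong-≗ (λ w → trans (cong (A u w *_) (walks-+ p q w v))
                                 (*-distribˡ-sum (A u w) (λ x → walks p w x * walks q x v))) ⟩
    ∑[ w < n ] ∑[ x < n ] (A u w * (walks p w x * walks q x v))
      ≡⟨ ∑-comm (λ w x → A u w * (walks p w x * walks q x v)) ⟩
    ∑[ x < n ] ∑[ w < n ] (A u w * (walks p w x * walks q x v))
      ≡⟨ sum-cong-≗ (λ x → trans (sum-cong-≗ (λ w → sym (*-assoc (A u w) _ _)))
                                 (sym (*-distribʳ-sum (walks q x v) (λ w → A u w * walks p w x)))) ⟩
    ∑[ x < n ] (walks (suc p) u x * walks q x v) ∎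
    where open ≡-Reasoning

  walks-1 : ∀ u v → walks 1 u v ≡ A u v
  walks-1 u v = sum-δʳ v (A u)

  walks-sym : ∀ l u v → walks l u v ≡ walks l v u
  walks-sym zero    u v = δ-sym u v
  walks-sym (suc l) u v = begin
    ∑[ w < n ] (A u w * walks l w v)
      ≡⟨ sum-cong-≗ (λ w → trans (cong₂ _*_ (cong 𝟙 (SimpleGraph.sym G u w)) (walks-sym l w v))
                                 (*-comm (A w u) (walks l v w))) ⟩
    ∑[ w < n ] (walks l v w * A w u)
      ≡⟨ sum-cong-≗ (λ w → cong (walks l v w *_) (walks-1 w u)) ⟨
    ∑[ w < n ] (walks l v w * walks 1 w u)
      ≡⟨ walks-+ l 1 v u ⟨
    walks (l + 1) v u
      ≡⟨ cong (λ l′ → walks l′ v u) (+-comm l 1) ⟩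
    walks (suc l) v u ∎
    where open ≡-Reasoning

  closedWalks-+ : ∀ p q → closedWalks (p + q) ≡ ∑[ u < n ] ∑[ w < n ] (walks p u w * walks q w u)
  closedWalks-+ p q = sum-cong-≗ (λ u → walks-+ p q u u)

  closedWalks-double : ∀ p → closedWalks (p + p) ≡ ∑[ u < n ] ∑[ w < n ] (walks p u w * walks p u w)
  closedWalks-double p =
    trans (closedWalks-+ p p) (sum-cong-≗ (λ u → sum-cong-≗ (λ w → cong (walks p u w *_) (walks-sym p w u))))

  closedWalks-cauchy-schwarz : ∀ p q →
    closedWalks (p + q) * closedWalks (p + q) ≤ closedWalks (p + p) * closedWalks (q + q)
  closedWalks-cauchy-schwarz p q = begin
    closedWalks (p + q) * closedWalks (p + q)
      ≡⟨ cong (λ c → c * c) (closedWalks-+ p q) ⟩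
    (∑[ u < n ] ∑[ w < n ] (walks p u w * walks q w u)) * (∑[ u < n ] ∑[ w < n ] (walks p u w * walks q w u))
      ≤⟨ cauchy-schwarz _ _ _ (λ u → cauchy-schwarz _ _ _ (λ w →
           ≤-reflexive ([m*n]*[o*p]≡[m*o]*[n*p] (walks p u w) (walks q w u) (walks p u w) (walks q w u)))) ⟩
    (∑[ u < n ] ∑[ w < n ] (walks p u w * walks p u w)) * (∑[ u < n ] ∑[ w < n ] (walks q w u * walks q w u))
      ≡⟨ cong₂ _*_ (closedWalks-double p) (trans (closedWalks-double q)
           (sum-cong-≗ (λ u → sum-cong-≗ (λ w → cong (λ c → c * c) (walks-sym q u w))))) ⟨
    closedWalks (p + p) * closedWalks (q + q) ∎
    where open ≤-Reasoning

  sum-A*≤sum : ∀ u (g : Fin n → ℕ) → ∑[ w < n ] (A u w * g w) ≤ ∑[ w < n ] g w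
  sum-A*≤sum u g = sum-mono-≤ (λ w → 𝟙*≤ (adj G u w) (g w))
    where
    𝟙*≤ : ∀ b x → 𝟙 b * x ≤ x
    𝟙*≤ false x = z≤n
    𝟙*≤ true  x = ≤-reflexive (+-identityʳ x)

  walksFrom-suc : ∀ l u → walksFrom (suc l) u ≡ ∑[ w < n ] (A u w * walksFrom l w)
  walksFrom-suc l u = trans (∑-comm (λ v w → A u w * walks l w v))
                            (sum-cong-≗ (λ w → sym (*-distribˡ-sum (A u w) (λ v → walks l w v))))

  closedWalks-suc≤allWalks : ∀ l → closedWalks (suc l) ≤ allWalks l
  closedWalks-suc≤allWalks l = begin
    ∑[ u < n ] ∑[ w < n ] (A u w * walks l w u)
      ≤⟨ sum-mono-≤ (λ u → sum-A*≤sum u (λ w → walks l w u)) ⟩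
    ∑[ u < n ] ∑[ w < n ] walks l w u
      ≡⟨ ∑-comm (λ u w → walks l w u) ⟩
    allWalks l ∎
    where open ≤-Reasoning

  allWalks-suc-suc : ∀ l → allWalks (suc (suc l)) ≤ arcCount * allWalks l
  allWalks-suc-suc l = begin
    ∑[ u < n ] walksFrom (suc (suc l)) u
      ≡⟨ sum-cong-≗ (walksFrom-suc (suc l)) ⟩
    ∑[ u < n ] ∑[ w < n ] (A u w * walksFrom (suc l) w)
      ≤⟨ sum-mono-≤ (λ u → sum-mono-≤ (λ w → *-monoʳ-≤ (A u w) (begin
           walksFrom (suc l) w                  ≡⟨ walksFrom-suc l w ⟩
           ∑[ x < n ] (A w x * walksFrom l x)   ≤⟨ sum-A*≤sum w (walksFrom l) ⟩
           allWalks l                           ∎))) ⟩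
    ∑[ u < n ] ∑[ w < n ] (A u w * allWalks l)
      ≡⟨ sum-cong-≗ (λ u → *-distribʳ-sum (allWalks l) (A u)) ⟨
    ∑[ u < n ] (∑[ w < n ] A u w * allWalks l)
      ≡⟨ *-distribʳ-sum (allWalks l) (λ u → ∑[ w < n ] A u w) ⟨
    arcCount * allWalks l ∎
    where open ≤-Reasoning

  allWalks-odd : ∀ p → allWalks (suc (p + p)) ≤ arcCount ^ suc p
  allWalks-odd zero    = ≤-reflexive (trans allWalks-1 (sym (*-identityʳ arcCount)))
    where
    allWalks-1 : allWalks 1 ≡ arcCount
    allWalks-1 = sum-cong-≗ (λ u → sum-cong-≗ (walks-1 u))
  allWalks-odd (suc p) = begin
    allWalks (suc (suc (p + suc p)))   ≤⟨ allWalks-suc-suc (p + suc p) ⟩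
    arcCount * allWalks (p + suc p)    ≡⟨ cong (λ l → arcCount * allWalks l) (+-suc p p) ⟩
    arcCount * allWalks (suc (p + p))  ≤⟨ *-monoʳ-≤ arcCount (allWalks-odd p) ⟩
    arcCount ^ suc (suc p)             ∎
    where open ≤-Reasoning

  closedWalks-even : ∀ p → closedWalks (suc p + suc p) ≤ arcCount ^ suc p
  closedWalks-even p = begin
    closedWalks (suc (p + suc p))  ≤⟨ closedWalks-suc≤allWalks (p + suc p) ⟩
    allWalks (p + suc p)           ≡⟨ cong allWalks (+-suc p p) ⟩
    allWalks (suc (p + p))         ≤⟨ allWalks-odd p ⟩
    arcCount ^ suc p               ∎
    where open ≤-Reasoning

  ascendingArc : Fin n → Fin n → ℕ
  ascendingArc u v = 𝟙 ((toℕ u <ᵇ toℕ v) ∧ adj G u v)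

  A≡ascendingArc+ascendingArc : ∀ u v → A u v ≡ ascendingArc u v + ascendingArc v u
  A≡ascendingArc+ascendingArc u v with <-cmp (toℕ u) (toℕ v)
  ... | tri< u<v _ _ rewrite <ᵇ-true u<v | <ᵇ-false (<⇒≤ u<v) = sym (+-identityʳ (A u v))
  ... | tri≈ _ u≡v _ rewrite toℕ-injective u≡v | <ᵇ-false (≤-refl {toℕ v}) = cong 𝟙 (irrefl G v)
  ... | tri> _ _ v<u rewrite <ᵇ-false (<⇒≤ v<u) | <ᵇ-true v<u = cong 𝟙 (SimpleGraph.sym G u v)

  arcCount≡edgeCount+edgeCount : arcCount ≡ edgeCount G + edgeCount G
  arcCount≡edgeCount+edgeCount = begin
    ∑[ u < n ] ∑[ v < n ] A u v
      ≡⟨ sum-cong-≗ (λ u → trans (sum-cong-≗ (A≡ascendingArc+ascendingArc u))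
                                 (∑-distrib-+ (arc u) (λ v → arc v u))) ⟩
    ∑[ u < n ] (∑[ v < n ] arc u v + ∑[ v < n ] arc v u)
      ≡⟨ ∑-distrib-+ (λ u → ∑[ v < n ] arc u v) (λ u → ∑[ v < n ] arc v u) ⟩
    ∑[ u < n ] ∑[ v < n ] arc u v + ∑[ u < n ] ∑[ v < n ] arc v u
      ≡⟨ cong (∑[ u < n ] ∑[ v < n ] arc u v +_) (∑-comm (λ u v → arc v u)) ⟩
    ∑[ u < n ] ∑[ v < n ] arc u v + ∑[ u < n ] ∑[ v < n ] arc u v
      ≡⟨ cong₂ _+_ edgeCount≡ edgeCount≡ ⟨
    edgeCount G + edgeCount G ∎
    where
    open ≡-Reasoning
    arc : Fin n → Fin n → ℕ
    arc = ascendingArc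
    edgeCount≡ : edgeCount G ≡ ∑[ u < n ] ∑[ v < n ] arc u v
    edgeCount≡ = trans (sumFin≡sum n _) (sum-cong-≗ (λ u → sumFin≡sum n (arc u)))

-- Subgraphs traced out by walks

reverse : {A : Set} → ℕ → (ℕ → A) → ℕ → A
reverse k w t = w (k ∸ t)

Traverses : {A : Set} → (ℕ → A) → ℕ → A → A → Set
Traverses w t x y = (x , y) ≡ (w t , w (suc t)) ⊎ (y , x) ≡ (w t , w (suc t))

record Traces {n} {G : SimpleGraph n} (k : ℕ) (w : ℕ → Fin n) (H : Subgraph G) : Set where
  field
    visits-vert    : ∀ {t} → t ≤ k → vert H (w t) ≡ true
    vert-visited   : ∀ {x} → vert H x ≡ true → ∃[ t ] t ≤ k × w t ≡ x
    traverses-edge : ∀ {t} → t < k → edge H (w t) (w (suc t)) ≡ true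
    edge-traversed : ∀ {x y} → edge H x y ≡ true → ∃[ t ] t < k × Traverses w t x y
open Traces

module _ {n} {G : SimpleGraph n} {k : ℕ} where

  traversed⇒edge : ∀ {w} {H : Subgraph G} {t x y} →
                   Traces k w H → t < k → Traverses w t x y → edge H x y ≡ true
  traversed⇒edge         τ t<k (inj₁ refl) = traverses-edge τ t<k
  traversed⇒edge {H = H} τ t<k (inj₂ refl) = trans (edge-sym H _ _) (traverses-edge τ t<k)

  traces-unique : ∀ {w} {H H′ : Subgraph G} → Traces k w H → Traces k w H′ → SameSubgraph H H′
  traces-unique τ τ′ = (λ x → ⇔→≡ (mk⇔ (vert-⊆ τ τ′) (vert-⊆ τ′ τ)))
                     , (λ x y → ⇔→≡ (mk⇔ (edge-⊆ τ τ′) (edge-⊆ τ′ τ)))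
    where
    vert-⊆ : ∀ {w} {H₁ H₂ : Subgraph G} {x} →
             Traces k w H₁ → Traces k w H₂ → vert H₁ x ≡ true → vert H₂ x ≡ true
    vert-⊆ τ₁ τ₂ x∈ with t , t≤k , refl ← vert-visited τ₁ x∈ = visits-vert τ₂ t≤k
    edge-⊆ : ∀ {w} {H₁ H₂ : Subgraph G} {x y} →
             Traces k w H₁ → Traces k w H₂ → edge H₁ x y ≡ true → edge H₂ x y ≡ true
    edge-⊆ τ₁ τ₂ xy∈ with t , t<k , traversal ← edge-traversed τ₁ xy∈ =
      traversed⇒edge τ₂ t<k traversal

  traces-resp-≈ : ∀ {w w′} {H : Subgraph G} → w ≈[ k ] w′ → Traces k w H → Traces k w′ H
  traces-resp-≈ {w} {w′} {H} w≈w′ τ = record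
    { visits-vert    = λ t≤k → subst (λ x → vert H x ≡ true) (w≈w′ _ t≤k) (visits-vert τ t≤k)
    ; vert-visited   = λ x∈ → let t , t≤k , wₜ≡x = vert-visited τ x∈ in
                       t , t≤k , trans (sym (w≈w′ t t≤k)) wₜ≡x
    ; traverses-edge = λ t<k → subst (λ (x , y) → edge H x y ≡ true) (same-step t<k) (traverses-edge τ t<k)
    ; edge-traversed = λ xy∈ → let t , t<k , traversal = edge-traversed τ xy∈ in
                       t , t<k , Sum.map (λ e → trans e (same-step t<k))
                                         (λ e → trans e (same-step t<k)) traversal
    }
    where
    same-step : ∀ {t} → t < k → (w t , w (suc t)) ≡ (w′ t , w′ (suc t))
    same-step {t} t<k = cong₂ _,_ (w≈w′ t (<⇒≤ t<k)) (w≈w′ (suc t) t<k)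

  -- Step t of w is step k ∸ suc t of the reverse, run backwards; k ∸ t = suc (k ∸ suc t) is +-∸-assoc 1.
  traces-reverse : ∀ {w} {H : Subgraph G} → Traces k w H → Traces k (reverse k w) H
  traces-reverse {w} {H} τ = record
    { visits-vert    = λ {t} _ → visits-vert τ (m∸n≤m k t)
    ; vert-visited   = λ x∈ → let t , t≤k , wₜ≡x = vert-visited τ x∈ in
                       k ∸ t , m∸n≤m k t , trans (cong w (m∸[m∸n]≡n t≤k)) wₜ≡x
    ; traverses-edge = λ {t} t<k → subst (λ s → edge H (w s) (w (k ∸ suc t)) ≡ true) (sym (+-∸-assoc 1 t<k))
                         (trans (edge-sym H _ _) (traverses-edge τ (∸-monoʳ-< z<s t<k)))
    ; edge-traversed = λ xy∈ → let t , t<k , traversal = edge-traversed τ xy∈ in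
                       k ∸ suc t , ∸-monoʳ-< z<s t<k ,
                       Sum.swap (Sum.map (λ e → trans (cong swap e) (reversed-step t<k))
                                         (λ e → trans (cong swap e) (reversed-step t<k)) traversal)
    }
    where
    reversed-step : ∀ {t} → t < k →
                    (w (suc t) , w t) ≡ (reverse k w (k ∸ suc t) , reverse k w (suc (k ∸ suc t)))
    reversed-step {t} t<k =
      cong₂ _,_ (cong w (sym (m∸[m∸n]≡n t<k)))
                (cong w (sym (trans (cong (k ∸_) (sym (+-∸-assoc 1 t<k))) (m∸[m∸n]≡n (<⇒≤ t<k)))))

  closed-traces⇒isWalk : ∀ {w} {H : Subgraph G} → Traces k w H → w k ≡ w 0 → IsWalk G k (w 0) (w 0) w
  closed-traces⇒isWalk {H = H} τ closed = record
    { starts = refl ; ends = closed ; steps = λ t<k → edge-adj H _ _ (traverses-edge τ t<k) }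

-- Cycles as closed walks

module _ {k : ℕ} .{{_ : NonZero k}} where

  toℕ-mod : ∀ {t} → t < k → toℕ (t mod k) ≡ t
  toℕ-mod t<k = trans (toℕ-fromℕ< _) (m<n⇒m%n≡m t<k)

  toℕ-mod-self : toℕ (k mod k) ≡ 0
  toℕ-mod-self = trans (toℕ-fromℕ< _) (n%n≡0 k)

  toℕ-mod-inverse : (a : Fin k) → toℕ a mod k ≡ a
  toℕ-mod-inverse a = toℕ-injective (toℕ-mod (toℕ<n a))

  cycSucc⇒mod : ∀ {a b} → CycSucc k a b → suc (toℕ a) mod k ≡ b
  cycSucc⇒mod (inj₁ 1+a≡b)         = trans (cong (_mod k) 1+a≡b) (toℕ-mod-inverse _)
  cycSucc⇒mod (inj₂ (1+a≡k , b≡0)) =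
    toℕ-injective (trans (cong (λ t → toℕ (t mod k)) 1+a≡k) (trans toℕ-mod-self (sym b≡0)))

  mod⇒cycSucc : ∀ {t} → t < k → CycSucc k (t mod k) (suc t mod k)
  mod⇒cycSucc {t} t<k with m≤n⇒m<n∨m≡n t<k
  ... | inj₁ 1+t<k = inj₁ (trans (cong suc (toℕ-mod t<k)) (sym (toℕ-mod 1+t<k)))
  ... | inj₂ 1+t≡k = inj₂ ( trans (cong suc (toℕ-mod t<k)) 1+t≡k
                          , trans (cong (λ s → toℕ (s mod k)) 1+t≡k) toℕ-mod-self)

  module _ {n} {G : SimpleGraph n} {H : Subgraph G} where

    cycleWalk : IsCycleOfLength k H → ℕ → Fin n
    cycleWalk (φ , _) t = φ (t mod k)

    cycleWalk-closed : (c : IsCycleOfLength k H) → cycleWalk c k ≡ cycleWalk c 0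
    cycleWalk-closed (φ , _) = cong φ (toℕ-injective (trans toℕ-mod-self (sym (toℕ-mod (>-nonZero⁻¹ k)))))

    cycleWalk-traces : (c : IsCycleOfLength k H) → Traces k (cycleWalk c) H
    cycleWalk-traces c@(φ , _ , φ∈H , onto , edge⇒adj , adj⇒edge) = record
      { visits-vert    = λ _ → φ∈H _
      ; vert-visited   = λ x∈ → let a , φa≡x = onto _ x∈ in
                         toℕ a , <⇒≤ (toℕ<n a) , trans (cong φ (toℕ-mod-inverse a)) φa≡x
      ; traverses-edge = λ t<k → adj⇒edge _ _ (inj₁ (mod⇒cycSucc t<k))
      ; edge-traversed = traversal
      }
      where
      succ-step : ∀ {a b} → CycSucc k a b →
                  (φ a , φ b) ≡ (cycleWalk c (toℕ a) , cycleWalk c (suc (toℕ a)))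
      succ-step {a} a→b = cong₂ _,_ (cong φ (sym (toℕ-mod-inverse a))) (cong φ (sym (cycSucc⇒mod a→b)))
      traversal : ∀ {x y} → edge H x y ≡ true → ∃[ t ] t < k × Traverses (cycleWalk c) t x y
      traversal {x} {y} xy∈ with edge-end H x y xy∈
      ... | x∈ , y∈ with onto x x∈ | onto y y∈
      ... | a , refl | b , refl with edge⇒adj a b xy∈
      ... | inj₁ a→b = toℕ a , toℕ<n a , inj₁ (succ-step a→b)
      ... | inj₂ b→a = toℕ b , toℕ<n b , inj₂ (succ-step b→a)

    -- Agreement at time 1 would give φ 1 = φ (k ∸ 1), hence 1 = k ∸ 1 by injectivity.
    cycleWalk-irreversible : 3 ≤ k → (c : IsCycleOfLength k H) →
                             ¬ (cycleWalk c ≈[ k ] reverse k (cycleWalk c))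
    cycleWalk-irreversible (s≤s (s≤s (s≤s _))) (φ , φ-injective , _) w≈w̃
      with () ← trans (sym (toℕ-mod (s≤s (s≤s z≤n))))
                      (trans (cong toℕ (φ-injective (w≈w̃ 1 (s≤s z≤n)))) (toℕ-mod (n<1+n _)))

module _ {n} {G : SimpleGraph n} {k} .{{_ : NonZero k}} {m} {cs : Fin m → Subgraph G}
         (cycles : ∀ i → IsCycleOfLength k (cs i)) where

  walk : Fin m → ℕ → Fin n
  walk i = cycleWalk {H = cs i} (cycles i)

  orientedWalk : Fin m ⊎ Fin m → ℕ → Fin n
  orientedWalk (inj₁ i) = walk i
  orientedWalk (inj₂ i) = reverse k (walk i)

  orientedWalk-traces : ∀ o → Traces k (orientedWalk o) (cs (reduce o))
  orientedWalk-traces (inj₁ i) = cycleWalk-traces (cycles i)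
  orientedWalk-traces (inj₂ i) = traces-reverse (cycleWalk-traces (cycles i))

  orientedWalk-closed : ∀ o → orientedWalk o k ≡ orientedWalk o 0
  orientedWalk-closed (inj₁ i) = cycleWalk-closed {H = cs i} (cycles i)
  orientedWalk-closed (inj₂ i) = trans (cong (walk i) (n∸n≡0 k)) (sym (cycleWalk-closed {H = cs i} (cycles i)))

  orientedWalk-isWalk : ∀ o → IsWalk G k (orientedWalk o 0) (orientedWalk o 0) (orientedWalk o)
  orientedWalk-isWalk o = closed-traces⇒isWalk (orientedWalk-traces o) (orientedWalk-closed o)

  module _ (3≤k : 3 ≤ k) (distinct : ∀ i j → SameSubgraph (cs i) (cs j) → i ≡ j) where

    same-cycle : ∀ {o o′} → orientedWalk o ≈[ k ] orientedWalk o′ → reduce o ≡ reduce o′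
    same-cycle {o} {o′} o≈o′ =
      distinct _ _ (traces-unique (traces-resp-≈ o≈o′ (orientedWalk-traces o)) (orientedWalk-traces o′))

    orientedWalk-injective : ∀ {o o′} → orientedWalk o ≈[ k ] orientedWalk o′ → o ≡ o′
    orientedWalk-injective {inj₁ i} {inj₁ j} o≈o′ = cong inj₁ (same-cycle {inj₁ i} {inj₁ j} o≈o′)
    orientedWalk-injective {inj₂ i} {inj₂ j} o≈o′ = cong inj₂ (same-cycle {inj₂ i} {inj₂ j} o≈o′)
    orientedWalk-injective {inj₁ i} {inj₂ j} o≈o′ with refl ← same-cycle {inj₁ i} {inj₂ j} o≈o′ =
      contradiction o≈o′ (cycleWalk-irreversible {H = cs i} 3≤k (cycles i))
    orientedWalk-injective {inj₂ i} {inj₁ j} o≈o′ with refl ← same-cycle {inj₂ i} {inj₁ j} o≈o′ =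
      contradiction (≈-sym o≈o′) (cycleWalk-irreversible {H = cs i} 3≤k (cycles i))

    cycles≤closedWalks : m + m ≤ WalkCount.closedWalks G k
    cycles≤closedWalks = WalkCount.closedWalkFamily≤closedWalks G k (orientedWalk ∘ splitAt m)
      (orientedWalk-isWalk ∘ splitAt m) (λ x≈y → splitAt-injective (orientedWalk-injective x≈y))
      where
      splitAt-injective : ∀ {x y} → splitAt m x ≡ splitAt m y → x ≡ y
      splitAt-injective {x} {y} eq =
        trans (sym (join-splitAt m m x)) (trans (cong (join m m) eq) (join-splitAt m m y))

mainTheorem4 : (n : ℕ) (G : SimpleGraph n) (k : ℕ) → 3 ≤ k →
    (m : ℕ) (cs : Fin m → Subgraph G) →
    (∀ i → IsCycleOfLength k (cs i)) →
    (∀ i j → SameSubgraph (cs i) (cs j) → i ≡ j) →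
    m * m ≤ 2 ^ (k ∸ 2) * edgeCount G ^ k
mainTheorem4 n G k@(suc (suc (suc j))) 3≤k@(s≤s (s≤s (s≤s _))) m cs cycles distinct =
  halve-square-bound m (edgeCount G) (suc j) (begin
    (m + m) * (m + m)                                ≤⟨ *-mono-≤ 2m≤closedWalks 2m≤closedWalks ⟩
    closedWalks k * closedWalks k                    ≤⟨ closedWalks-cauchy-schwarz 1 (2 + j) ⟩
    closedWalks 2 * closedWalks ((2 + j) + (2 + j))  ≤⟨ *-mono-≤ (closedWalks-even 0) (closedWalks-even (suc j)) ⟩
    arcCount ^ 1 * arcCount ^ (2 + j)                ≡⟨ ^-distribˡ-+-* arcCount 1 (2 + j) ⟨
    arcCount ^ k                                     ≡⟨ cong (_^ k) arcCount≡edgeCount+edgeCount ⟩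
    (edgeCount G + edgeCount G) ^ k                  ∎)
  where
  open WalkCount G
  open ≤-Reasoning
  2m≤closedWalks : m + m ≤ closedWalks k
  2m≤closedWalks = cycles≤closedWalks {G = G} {cs = cs} cycles 3≤k distinct
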